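{- Let $T$ be a tree with at least two vertices. Then every parity signed graph $T_f$ with underlying tree $T$ satisfies $|E^-(T_f)|=\sigma^-(T)$ (equivalently, the number of negative edges of $T_f$ is the same for all bijections $f$) if and only if $T$ is isomorphic to the star $K_{1,n}$ for some odd positive integer $n$.
   Context: For a simple graph $G$ with $N$ vertices and a bijection $f:V(G)\to\{1,\dots,N\}$, the parity signed graph $G_f$ is $G$ with each edge $uv$ given sign $+$ if $f(u),f(v)$ have the same parity and $-$ otherwise; $E^-(G_f)$ denotes its set of negative edges. The `rna' number $\sigma^-(G)$ is the minimum of $|E^-(G_f)|$ over all such bijections $f$. -}

module Defs where

open import Data.Nat using (ℕ; zero; suc; _+_; _%_; _<_; _≤_; _≥_)
open import Data.Nat.Properties using (_<?_)
open import Data.Bool using (Bool; true; false; _∧_; _xor_; if_then_else_)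
open import Data.Fin using (Fin; toℕ)
open import Data.Fin.Permutation using (Permutation′; _⟨$⟩ʳ_)
open import Data.Nat.ListAction using (sum)
open import Data.List using (List; []; _∷_; length; map; allFin; head; last)
open import Data.List.Relation.Unary.Unique.Propositional using (Unique)
open import Data.Maybe using (just)
open import Data.Product using (Σ; ∃; _×_; _,_)
open import Relation.Binary.PropositionalEquality using (_≡_)
open import Relation.Nullary.Decidable using (does)
open import Relation.Nullary using (¬_)
open import Function.Bundles using (_↔_; Inverse)

record Graph : Set where
  field
    N     : ℕ
    adj   : Fin N → Fin N → Bool
    sym   : ∀ u v → adj u v ≡ adj v u
    irrefl : ∀ v → adj v v ≡ false
open Graph public

data Reach (G : Graph) : Fin (N G) → Fin (N G) → Set where
  here : ∀ {v} → Reach G v v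
  step : ∀ {u v w} → adj G u v ≡ true → Reach G v w → Reach G u w

Connected : Graph → Set
Connected G = ∀ u v → Reach G u v

data Path (G : Graph) : List (Fin (N G)) → Set where
  p0 : Path G []
  p1 : ∀ {v} → Path G (v ∷ [])
  p2 : ∀ {u v vs} → adj G u v ≡ true → Path G (v ∷ vs) → Path G (u ∷ v ∷ vs)

record Cycle (G : Graph) : Set where
  field
    verts    : List (Fin (N G))
    long     : length verts ≥ 3
    distinct : Unique verts
    path     : Path G verts
    closing  : ∃ λ a → ∃ λ b → head verts ≡ just a × last verts ≡ just b × adj G b a ≡ true

Acyclic : Graph → Set
Acyclic G = ¬ Cycle G

IsTree : Graph → Set
IsTree G = Connected G × Acyclic G

-- Labelling bijection f : V → {1,…,N}, given by a permutation π of Fin N,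
-- f(v) = toℕ (π v) + 1.
label : (G : Graph) → Permutation′ (N G) → Fin (N G) → ℕ
label G π v = suc (toℕ (π ⟨$⟩ʳ v))

parity : ℕ → Bool
parity n with n % 2
... | zero = false
... | suc _ = true

-- uv is a negative edge of G_f (counted once per unordered pair u < v).
negEdge : (G : Graph) → Permutation′ (N G) → Fin (N G) → Fin (N G) → Bool
negEdge G π u v =
  does (toℕ u <? toℕ v) ∧ adj G u v ∧ (parity (label G π u) xor parity (label G π v))

toN : Bool → ℕ
toN true = 1
toN false = 0

negCount : (G : Graph) → Permutation′ (N G) → ℕ
negCount G π = sum (map (λ u → sum (map (λ v → toN (negEdge G π u v)) (allFin (N G)))) (allFin (N G)))

-- k = σ⁻(G): k is the minimum of |E⁻(G_f)| over all bijections f.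
IsRna : Graph → ℕ → Set
IsRna G k = (∃ λ π → negCount G π ≡ k) × (∀ π → k ≤ negCount G π)

starAdj : (n : ℕ) → Fin (suc n) → Fin (suc n) → Bool
starAdj n Fin.zero Fin.zero = false
starAdj n Fin.zero (Fin.suc _) = true
starAdj n (Fin.suc _) Fin.zero = true
starAdj n (Fin.suc _) (Fin.suc _) = false

star : ℕ → Graph
star n = record { N = suc n ; adj = starAdj n ; sym = s ; irrefl = i }
  where
  s : ∀ u v → starAdj n u v ≡ starAdj n v u
  s Fin.zero Fin.zero = _≡_.refl
  s Fin.zero (Fin.suc _) = _≡_.refl
  s (Fin.suc _) Fin.zero = _≡_.refl
  s (Fin.suc _) (Fin.suc _) = _≡_.refl
  i : ∀ v → starAdj n v v ≡ false
  i Fin.zero = _≡_.refl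
  i (Fin.suc _) = _≡_.refl

Iso : Graph → Graph → Set
Iso G H = Σ (Fin (N G) ↔ Fin (N H)) λ φ →
  ∀ u v → adj H (Inverse.to φ u) (Inverse.to φ v) ≡ adj G u v

Odd : ℕ → Set
Odd n = n % 2 ≡ 1

-- Only the colouring of the vertices by label parity matters, and 2|E⁻(T_f)| is the cut of
-- that colouring counted over ordered pairs. Give u, x odd and v, y even labels, and swap the
-- labels of u, v and/or of x, y: the second difference cut₀ + cut₃ − cut₁ − cut₂ of the four
-- cuts only sees edges between {u, v} and {x, y}, and equals 4(uy + vx − ux − vy). So if
-- |E⁻| is constant then ux + vy = uy + vx for any four distinct vertices; for two disjoint
-- edges this yields a triangle. A connected graph without triangles or disjoint edges is a
-- star, and on a star with centre s, |E⁻| counts the labels whose parity differs from that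
-- of f(s), which is independent of f exactly when the number of vertices is even.
-- The hypothesis quantifies over σ⁻, whose existence is only available up to double
-- negation; decidability of equality on ℕ makes that enough.

module Submission where

open import Defs hiding (sym)
open import Data.Nat using (ℕ; zero; suc; _+_; _*_; _%_; _≤_; _<_; _≥_; z≤n; s≤s; pred; >-nonZero)
open import Data.Nat.Properties hiding (_≟_)
import Data.Nat.Properties as ℕ
open import Data.Nat.Induction using (<-rec)
open import Data.Nat.Solver using (module +-*-Solver)
import Data.Nat.ListAction as List
open import Data.Bool using (Bool; true; false; not; _∧_; _∨_; _xor_)
open import Data.Bool.Properties
  using (not-involutive; xor-comm; xor-same; ∧-zeroʳ; ∧-identityʳ; xor-∧-commutativeRing)
import Data.Bool.Properties as Bool
open import Data.Fin using (Fin; toℕ; inject≤; cast)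
open import Data.Fin.Patterns using (0F; 1F; 2F; 3F)
open import Data.Fin.Properties
  using (_≟_; any?; toℕ-injective; injective⇒≤; inject≤-injective; toℕ-inject≤)
open import Data.Fin.Permutation using (Permutation′; _⟨$⟩ʳ_; _⟨$⟩ˡ_; _∘ₚ_; transpose; ↔⇒≡)
import Data.Fin.Permutation as Perm
import Data.Fin.Permutation.Components as PC
open import Data.List using (map; tabulate; allFin; []; _∷_)
open import Data.List.Relation.Unary.All using ([]; _∷_)
open import Data.List.Relation.Unary.AllPairs using ([]; _∷_)
open import Data.Product using (∃; _×_; _,_; proj₁; proj₂)
open import Data.Sum using (_⊎_; inj₁; inj₂; [_,_]′)
open import Data.Empty using (⊥; ⊥-elim)
open import Function.Base using (_∘_; case_of_)
open import Function.Bundles using (Injection; Inverse; _↔_; _⇔_; mk⇔)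
open import Function.Properties.Inverse using (↔⇒↣)
open import Relation.Nullary using (¬_; yes; no; does; contradiction)
open import Relation.Nullary.Decidable using (dec-true; dec-false; decidable-stable; _×-dec_; ¬?)
open import Relation.Binary.Definitions using (tri<; tri≈; tri>)
open import Relation.Binary.PropositionalEquality
open import Algebra.Bundles using (CommutativeRing)
open import Algebra.Properties.CommutativeSemigroup (CommutativeRing.+-commutativeSemigroup xor-∧-commutativeRing)
  using () renaming (interchange to xor-interchange)
open import Algebra.Properties.Semiring.Sum +-*-semiring
  using (sum; sum-syntax; ∑-comm; ∑-distrib-+; sum-cong-≗; sum-permute; sum-replicate-zero; *-distribˡ-sum)

sum-map-tabulate : ∀ {a} {A : Set a} n (g : Fin n → A) (f : A → ℕ) →
  List.sum (map f (tabulate g)) ≡ ∑[ i < n ] f (g i)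
sum-map-tabulate zero    g f = refl
sum-map-tabulate (suc n) g f = cong (f (g Fin.zero) +_) (sum-map-tabulate n (g ∘ Fin.suc) f)

∑-pick : ∀ {n} (u : Fin n) (f : Fin n → ℕ) → ∑[ p < n ] (toN (does (p ≟ u)) * f p) ≡ f u
∑-pick {suc n} Fin.zero    f =
  trans (cong₂ _+_ (+-identityʳ (f Fin.zero)) (sum-replicate-zero n)) (+-identityʳ (f Fin.zero))
∑-pick {suc n} (Fin.suc u) f = ∑-pick u (f ∘ Fin.suc)

∑∑ : ∀ n → (Fin n → Fin n → ℕ) → ℕ
∑∑ n f = ∑[ p < n ] ∑[ q < n ] f p q

∑∑-cong : ∀ {n} {f g : Fin n → Fin n → ℕ} → (∀ p q → f p q ≡ g p q) → ∑∑ n f ≡ ∑∑ n g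
∑∑-cong f≡g = sum-cong-≗ (λ p → sum-cong-≗ (f≡g p))

∑∑-+ : ∀ {n} (f g : Fin n → Fin n → ℕ) → ∑∑ n (λ p q → f p q + g p q) ≡ ∑∑ n f + ∑∑ n g
∑∑-+ {n} f g =
  trans (sum-cong-≗ (λ p → ∑-distrib-+ (f p) (g p))) (∑-distrib-+ (λ p → sum (f p)) (λ p → sum (g p)))

∑∑-*ˡ : ∀ {n} k (f : Fin n → Fin n → ℕ) → ∑∑ n (λ p q → k * f p q) ≡ k * ∑∑ n f
∑∑-*ˡ {n} k f =
  sym (trans (*-distribˡ-sum k (λ p → ∑[ q < n ] f p q)) (sum-cong-≗ (λ p → *-distribˡ-sum k (f p))))

_<ᶠ_ : ∀ {n} → Fin n → Fin n → Bool
p <ᶠ q = does (toℕ p <? toℕ q)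

<ᶠ-split : ∀ {n} (p q : Fin n) (b : Bool) → (p ≡ q → b ≡ false) →
  toN (p <ᶠ q ∧ b) + toN (q <ᶠ p ∧ b) ≡ toN b
<ᶠ-split p q b diag with <-cmp (toℕ p) (toℕ q)
... | tri< p<q _ q≮p rewrite dec-true (toℕ p <? toℕ q) p<q | dec-false (toℕ q <? toℕ p) q≮p = +-identityʳ (toN b)
... | tri> p≮q _ q<p rewrite dec-false (toℕ p <? toℕ q) p≮q | dec-true (toℕ q <? toℕ p) q<p = refl
... | tri≈ _ p≡q _ rewrite diag (toℕ-injective p≡q) | ∧-zeroʳ (p <ᶠ q) | ∧-zeroʳ (q <ᶠ p) = refl

∑∑-ordered-pairs : ∀ {n} (B : Fin n → Fin n → Bool) →
  (∀ p q → B p q ≡ B q p) → (∀ p → B p p ≡ false) →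
  2 * ∑∑ n (λ p q → toN (p <ᶠ q ∧ B p q)) ≡ ∑∑ n (λ p q → toN (B p q))
∑∑-ordered-pairs {n} B B-sym B-irrefl = begin
    2 * ∑∑ n f
  ≡⟨ cong (∑∑ n f +_) (+-identityʳ (∑∑ n f)) ⟩
    ∑∑ n f + ∑∑ n f
  ≡⟨ cong (∑∑ n f +_) (∑-comm f) ⟩
    ∑∑ n f + ∑∑ n (λ p q → f q p)
  ≡⟨ ∑∑-+ f (λ p q → f q p) ⟨
    ∑∑ n (λ p q → f p q + f q p)
  ≡⟨ ∑∑-cong (λ p q → trans (cong (λ b → f p q + toN (q <ᶠ p ∧ b)) (B-sym q p))
                             (<ᶠ-split p q (B p q) (λ { refl → B-irrefl p }))) ⟩
    ∑∑ n (λ p q → toN (B p q))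
  ∎
  where
  open ≡-Reasoning
  f : Fin n → Fin n → ℕ
  f p q = toN (p <ᶠ q ∧ B p q)

∑∑-linear : ∀ {n} (f g h : Fin n → Fin n → ℕ) →
  ∑∑ n (λ p q → f p q + g p q + 2 * h p q) ≡ ∑∑ n f + ∑∑ n g + 2 * ∑∑ n h
∑∑-linear f g h = trans (∑∑-+ (λ p q → f p q + g p q) (λ p q → 2 * h p q))
                        (cong₂ _+_ (∑∑-+ f g) (∑∑-*ˡ 2 h))

Colouring : ℕ → Set
Colouring n = Fin n → Bool

colour : (G : Graph) → Permutation′ (N G) → Colouring (N G)
colour G π v = parity (label G π v)

crossing : (G : Graph) → Colouring (N G) → Fin (N G) → Fin (N G) → Bool
crossing G c p q = adj G p q ∧ (c p xor c q)

cut₂ : (G : Graph) → Colouring (N G) → ℕ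
cut₂ G c = ∑∑ (N G) (λ p q → toN (crossing G c p q))

cut₂-cong : ∀ G {c c′ : Colouring (N G)} → (∀ p → c p ≡ c′ p) → cut₂ G c ≡ cut₂ G c′
cut₂-cong G c≗c′ = ∑∑-cong (λ p q → cong₂ (λ a b → toN (adj G p q ∧ (a xor b))) (c≗c′ p) (c≗c′ q))

negCount≡cut₂ : ∀ G π → 2 * negCount G π ≡ cut₂ G (colour G π)
negCount≡cut₂ G π = trans (cong (2 *_) negCount-∑∑) (∑∑-ordered-pairs (crossing G c) crossing-sym crossing-irrefl)
  where
  n = N G
  c = colour G π
  negCount-∑∑ : negCount G π ≡ ∑∑ n (λ p q → toN (p <ᶠ q ∧ crossing G c p q))
  negCount-∑∑ =
    trans (sum-map-tabulate n (λ p → p) (λ p → List.sum (map (λ q → toN (negEdge G π p q)) (allFin n))))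
          (sum-cong-≗ (λ p → sum-map-tabulate n (λ q → q) (λ q → toN (negEdge G π p q))))
  crossing-sym : ∀ p q → crossing G c p q ≡ crossing G c q p
  crossing-sym p q = cong₂ _∧_ (Graph.sym G p q) (xor-comm (c p) (c q))
  crossing-irrefl : ∀ p → crossing G c p p ≡ false
  crossing-irrefl p rewrite Graph.irrefl G p = refl

toggle : ∀ {n} → Colouring n → Colouring n → Colouring n
toggle α c p = α p xor c p

splitBoth : ∀ {n} → Colouring n → Colouring n → Fin n → Fin n → Bool
splitBoth α β p q = (α p xor α q) ∧ (β p xor β q)

adjWeight : (G : Graph) → (Fin (N G) → Fin (N G) → Bool) → Fin (N G) → Fin (N G) → ℕ
adjWeight G s p q = toN (adj G p q ∧ s p q)

link₂ : (G : Graph) (α β : Colouring (N G)) → (Fin (N G) → Fin (N G) → Bool) → ℕ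
link₂ G α β s = ∑∑ (N G) (λ p q → toN (splitBoth α β p q) * adjWeight G s p q)

-- For a single pair: e is adjacency, d says whether c separates it, a and b whether α and β do.
cut₂-square-pointwise : ∀ a b d e →
  toN (e ∧ d) + toN (e ∧ (b xor (a xor d))) + 2 * (toN (a ∧ b) * toN (e ∧ not d))
  ≡ toN (e ∧ (a xor d)) + toN (e ∧ (b xor d)) + 2 * (toN (a ∧ b) * toN (e ∧ d))
cut₂-square-pointwise false b     d     e     = refl
cut₂-square-pointwise true  false d     e     = cong (_+ 0) (+-comm (toN (e ∧ d)) (toN (e ∧ not d)))
cut₂-square-pointwise true  true  false false = refl
cut₂-square-pointwise true  true  false true  = refl
cut₂-square-pointwise true  true  true  false = refl
cut₂-square-pointwise true  true  true  true  = refl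

cut₂-square : ∀ G (c α β : Colouring (N G)) →
  cut₂ G c + cut₂ G (toggle β (toggle α c)) + 2 * link₂ G α β (λ p q → not (c p xor c q))
  ≡ cut₂ G (toggle α c) + cut₂ G (toggle β c) + 2 * link₂ G α β (λ p q → c p xor c q)
cut₂-square G c α β = begin
    cut₂ G c + cut₂ G c₃ + 2 * link₂ G α β (λ p q → not (d p q))
  ≡⟨ ∑∑-linear {N G} _ _ _ ⟨
    ∑∑ (N G) (λ p q → toN (e p q ∧ d p q) + toN (crossing G c₃ p q) + 2 * (σ p q * toN (e p q ∧ not (d p q))))
  ≡⟨ ∑∑-cong pointwise ⟩
    ∑∑ (N G) (λ p q → toN (crossing G c₁ p q) + toN (crossing G c₂ p q) + 2 * (σ p q * toN (e p q ∧ d p q)))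
  ≡⟨ ∑∑-linear {N G} _ _ _ ⟩
    cut₂ G c₁ + cut₂ G c₂ + 2 * link₂ G α β d
  ∎
  where
  open ≡-Reasoning
  c₁ = toggle α c
  c₂ = toggle β c
  c₃ = toggle β c₁
  e = adj G
  d : Fin (N G) → Fin (N G) → Bool
  d p q = c p xor c q
  σ : Fin (N G) → Fin (N G) → ℕ
  σ p q = toN (splitBoth α β p q)
  toggled : ∀ γ (c′ : Colouring (N G)) p q →
    toggle γ c′ p xor toggle γ c′ q ≡ (γ p xor γ q) xor (c′ p xor c′ q)
  toggled γ c′ p q = xor-interchange (γ p) (c′ p) (γ q) (c′ q)
  pointwise : ∀ p q →
    toN (e p q ∧ d p q) + toN (crossing G c₃ p q) + 2 * (σ p q * toN (e p q ∧ not (d p q)))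
    ≡ toN (crossing G c₁ p q) + toN (crossing G c₂ p q) + 2 * (σ p q * toN (e p q ∧ d p q))
  pointwise p q
    rewrite toggled β c₁ p q | toggled α c p q | toggled β c p q
    = cut₂-square-pointwise (α p xor α q) (β p xor β q) (d p q) (e p q)

pair : ∀ {n} → Fin n → Fin n → Colouring n
pair u v p = does (p ≟ u) ∨ does (p ≟ v)

pair-outside : ∀ {n} {u v p : Fin n} → p ≢ u → p ≢ v → pair u v p ≡ false
pair-outside {u = u} {v} {p} p≢u p≢v rewrite dec-false (p ≟ u) p≢u | dec-false (p ≟ v) p≢v = refl

∑-pair : ∀ {n} {u v : Fin n} → u ≢ v → (f : Fin n → ℕ) → ∑[ p < n ] (toN (pair u v p) * f p) ≡ f u + f v
∑-pair {n} {u} {v} u≢v f =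
  trans (sum-cong-≗ split) (trans (∑-distrib-+ (δ u) (δ v)) (cong₂ _+_ (∑-pick u f) (∑-pick v f)))
  where
  δ : Fin n → Fin n → ℕ
  δ w p = toN (does (p ≟ w)) * f p
  split : ∀ p → toN (pair u v p) * f p ≡ δ u p + δ v p
  split p with p ≟ u
  ... | yes refl rewrite dec-false (p ≟ v) u≢v = sym (+-identityʳ _)
  ... | no _     = refl

pairs-disjoint : ∀ {n} {u v x y : Fin n} → u ≢ x → u ≢ y → v ≢ x → v ≢ y →
  ∀ p → pair u v p ∧ pair x y p ≡ false
pairs-disjoint {u = u} {v} {x} {y} u≢x u≢y v≢x v≢y p with p ≟ u | p ≟ v
... | yes refl | _        rewrite pair-outside u≢x u≢y = refl
... | no _     | yes refl rewrite pair-outside v≢x v≢y = refl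
... | no _     | no _     = refl

splitBoth-disjoint : ∀ {ap bp aq bq} → ap ∧ bp ≡ false → aq ∧ bq ≡ false →
  toN ((ap xor aq) ∧ (bp xor bq)) ≡ toN ap * toN bq + toN bp * toN aq
splitBoth-disjoint {false} {false}                 _ q-disj = cong toN q-disj
splitBoth-disjoint {true}  {false} {false} {false} _ _  = refl
splitBoth-disjoint {true}  {false} {false} {true}  _ _  = refl
splitBoth-disjoint {true}  {false} {true}  {false} _ _  = refl
splitBoth-disjoint {true}  {false} {true}  {true}  _ ()
splitBoth-disjoint {false} {true}  {false} {false} _ _  = refl
splitBoth-disjoint {false} {true}  {false} {true}  _ _  = refl
splitBoth-disjoint {false} {true}  {true}  {false} _ _  = refl
splitBoth-disjoint {false} {true}  {true}  {true}  _ ()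
splitBoth-disjoint {true}  {true}                  () _

link₂-pairs : ∀ G {u v x y : Fin (N G)} → u ≢ v → x ≢ y → u ≢ x → u ≢ y → v ≢ x → v ≢ y →
  (s : Fin (N G) → Fin (N G) → Bool) → (∀ p q → s p q ≡ s q p) →
  link₂ G (pair u v) (pair x y) s
  ≡ 2 * ((adjWeight G s u x + adjWeight G s u y) + (adjWeight G s v x + adjWeight G s v y))
link₂-pairs G {u} {v} {x} {y} u≢v x≢y u≢x u≢y v≢x v≢y s s-sym = begin
    link₂ G α β s
  ≡⟨ ∑∑-cong split ⟩
    ∑∑ n (λ p q → F p q + F q p)
  ≡⟨ ∑∑-+ F (λ p q → F q p) ⟩
    ∑∑ n F + ∑∑ n (λ p q → F q p)
  ≡⟨ cong (∑∑ n F +_) (trans (sym (∑-comm F)) (sym (+-identityʳ (∑∑ n F)))) ⟩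
    2 * ∑∑ n F
  ≡⟨ cong (2 *_) (sum-cong-≗ (λ p → sym (*-distribˡ-sum (toN (α p)) (λ q → toN (β q) * W p q)))) ⟩
    2 * ∑[ p < n ] (toN (α p) * ∑[ q < n ] (toN (β q) * W p q))
  ≡⟨ cong (2 *_) (trans (∑-pair u≢v _) (cong₂ _+_ (∑-pair x≢y (W u)) (∑-pair x≢y (W v)))) ⟩
    2 * ((W u x + W u y) + (W v x + W v y))
  ∎
  where
  open ≡-Reasoning
  open +-*-Solver
  n = N G
  α = pair u v
  β = pair x y
  W = adjWeight G s
  F : Fin n → Fin n → ℕ
  F p q = toN (α p) * (toN (β q) * W p q)
  W-sym : ∀ p q → W p q ≡ W q p
  W-sym p q = cong₂ (λ a b → toN (a ∧ b)) (Graph.sym G p q) (s-sym p q)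
  disjoint = pairs-disjoint u≢x u≢y v≢x v≢y
  split : ∀ p q → toN (splitBoth α β p q) * W p q ≡ F p q + F q p
  split p q = begin
      toN (splitBoth α β p q) * W p q
    ≡⟨ cong (_* W p q) (splitBoth-disjoint {α p} {β p} {α q} {β q} (disjoint p) (disjoint q)) ⟩
      (toN (α p) * toN (β q) + toN (β p) * toN (α q)) * W p q
    ≡⟨ solve 5 (λ ap bq bp aq w → (ap :* bq :+ bp :* aq) :* w := ap :* (bq :* w) :+ aq :* (bp :* w))
         refl (toN (α p)) (toN (β q)) (toN (β p)) (toN (α q)) (W p q) ⟩
      F p q + toN (α q) * (toN (β p) * W p q)
    ≡⟨ cong (λ w → F p q + toN (α q) * (toN (β p) * w)) (W-sym p q) ⟩
      F p q + F q p
    ∎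

transpose-toggle : ∀ {n} {c : Colouring n} {u v : Fin n} → c v ≡ not (c u) →
  ∀ p → c (PC.transpose u v p) ≡ toggle (pair u v) c p
transpose-toggle {c = c} {u} {v} cv p with p ≟ u
... | yes refl = cv
... | no p≢u with p ≟ v
...   | yes refl = trans (sym (not-involutive (c u))) (cong not (sym cv))
...   | no p≢v = refl

cut₂-transpose-square : ∀ G (c : Colouring (N G)) {u v x y : Fin (N G)} →
  u ≢ v → u ≢ x → u ≢ y → v ≢ x → v ≢ y → x ≢ y →
  c u ≡ true → c v ≡ false → c x ≡ true → c y ≡ false →
  cut₂ G c + cut₂ G (c ∘ PC.transpose u v ∘ PC.transpose x y) + 4 * (toN (adj G u x) + toN (adj G v y))
  ≡ cut₂ G (c ∘ PC.transpose u v) + cut₂ G (c ∘ PC.transpose x y) + 4 * (toN (adj G u y) + toN (adj G v x))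
cut₂-transpose-square G c {u} {v} {x} {y} u≢v u≢x u≢y v≢x v≢y x≢y cu cv cx cy = begin
    cut₂ G c + cut₂ G (c′ ∘ PC.transpose x y) + 4 * (toN (adj G u x) + toN (adj G v y))
  ≡⟨ cong₂ (λ a b → cut₂ G c + a + b) (cut₂-cong G c₃≗) (sym (link same-sym same-weights)) ⟩
    cut₂ G c + cut₂ G (toggle β (toggle α c)) + 2 * link₂ G α β same
  ≡⟨ cut₂-square G c α β ⟩
    cut₂ G (toggle α c) + cut₂ G (toggle β c) + 2 * link₂ G α β diff
  ≡⟨ cong₂ _+_ (cong₂ _+_ (sym (cut₂-cong G c₁≗)) (sym (cut₂-cong G c₂≗))) (link diff-sym diff-weights) ⟩
    cut₂ G c′ + cut₂ G (c ∘ PC.transpose x y) + 4 * (toN (adj G u y) + toN (adj G v x))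
  ∎
  where
  open ≡-Reasoning
  α = pair u v
  β = pair x y
  c′ = c ∘ PC.transpose u v
  same diff : Fin (N G) → Fin (N G) → Bool
  same p q = not (c p xor c q)
  diff p q = c p xor c q
  same-sym : ∀ p q → same p q ≡ same q p
  same-sym p q = cong not (xor-comm (c p) (c q))
  diff-sym : ∀ p q → diff p q ≡ diff q p
  diff-sym p q = xor-comm (c p) (c q)
  c₁≗ : ∀ p → c′ p ≡ toggle α c p
  c₁≗ = transpose-toggle (trans cv (sym (cong not cu)))
  c₂≗ : ∀ p → c (PC.transpose x y p) ≡ toggle β c p
  c₂≗ = transpose-toggle (trans cy (sym (cong not cx)))
  c′-outside : ∀ {p} → p ≢ u → p ≢ v → c′ p ≡ c p
  c′-outside {p} p≢u p≢v = trans (c₁≗ p) (cong (_xor c p) (pair-outside p≢u p≢v))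
  c₃≗ : ∀ p → c′ (PC.transpose x y p) ≡ toggle β (toggle α c) p
  c₃≗ p = trans (transpose-toggle c′-y p) (cong (β p xor_) (c₁≗ p))
    where
    c′-y : c′ y ≡ not (c′ x)
    c′-y = trans (c′-outside (≢-sym u≢y) (≢-sym v≢y))
                 (trans cy (sym (cong not (trans (c′-outside (≢-sym u≢x) (≢-sym v≢x)) cx))))
  link : ∀ {s : Fin (N G) → Fin (N G) → Bool} {m} → (∀ p q → s p q ≡ s q p) →
    (adjWeight G s u x + adjWeight G s u y) + (adjWeight G s v x + adjWeight G s v y) ≡ m →
    2 * link₂ G α β s ≡ 4 * m
  link {s} {m} s-sym weights =
    trans (cong (2 *_) (trans (link₂-pairs G u≢v x≢y u≢x u≢y v≢x v≢y s s-sym) (cong (2 *_) weights)))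
          (sym (*-assoc 2 2 m))
  same-weights : (adjWeight G same u x + adjWeight G same u y) + (adjWeight G same v x + adjWeight G same v y)
    ≡ toN (adj G u x) + toN (adj G v y)
  same-weights rewrite cu | cv | cx | cy | ∧-identityʳ (adj G u x) | ∧-zeroʳ (adj G u y)
                     | ∧-zeroʳ (adj G v x) | ∧-identityʳ (adj G v y) = cong (_+ toN (adj G v y)) (+-identityʳ _)
  diff-weights : (adjWeight G diff u x + adjWeight G diff u y) + (adjWeight G diff v x + adjWeight G diff v y)
    ≡ toN (adj G u y) + toN (adj G v x)
  diff-weights rewrite cu | cv | cx | cy | ∧-zeroʳ (adj G u x) | ∧-identityʳ (adj G u y)
                     | ∧-identityʳ (adj G v x) | ∧-zeroʳ (adj G v y) = cong (toN (adj G u y) +_) (+-identityʳ _)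

four-distinct⇒4≤ : ∀ {n} {u v x y : Fin n} → u ≢ v → u ≢ x → u ≢ y → v ≢ x → v ≢ y → x ≢ y → 4 ≤ n
four-distinct⇒4≤ {n} {u} {v} {x} {y} u≢v u≢x u≢y v≢x v≢y x≢y = injective⇒≤ {f = table} injective
  where
  table : Fin 4 → Fin n
  table 0F = u
  table 1F = v
  table 2F = x
  table 3F = y
  injective : ∀ {i j} → table i ≡ table j → i ≡ j
  injective {0F} {0F} _ = refl
  injective {0F} {1F} e = contradiction e u≢v
  injective {0F} {2F} e = contradiction e u≢x
  injective {0F} {3F} e = contradiction e u≢y
  injective {1F} {0F} e = contradiction (sym e) u≢v
  injective {1F} {1F} _ = refl
  injective {1F} {2F} e = contradiction e v≢x
  injective {1F} {3F} e = contradiction e v≢y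
  injective {2F} {0F} e = contradiction (sym e) u≢x
  injective {2F} {1F} e = contradiction (sym e) v≢x
  injective {2F} {2F} _ = refl
  injective {2F} {3F} e = contradiction e x≢y
  injective {3F} {0F} e = contradiction (sym e) u≢y
  injective {3F} {1F} e = contradiction (sym e) v≢y
  injective {3F} {2F} e = contradiction (sym e) x≢y
  injective {3F} {3F} _ = refl

transpose-left : ∀ {n} (i j : Fin n) → PC.transpose i j i ≡ j
transpose-left i j rewrite dec-true (i ≟ i) refl = refl

transpose-other : ∀ {n} {i j k : Fin n} → k ≢ i → k ≢ j → PC.transpose i j k ≡ k
transpose-other {i = i} {j} {k} k≢i k≢j rewrite dec-false (k ≟ i) k≢i | dec-false (k ≟ j) k≢j = refl

redirect : ∀ {n} → Permutation′ n → Fin n → Fin n → Permutation′ n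
redirect π z t = π ∘ₚ transpose (π ⟨$⟩ʳ z) t

redirect-at : ∀ {n} (π : Permutation′ n) z t → redirect π z t ⟨$⟩ʳ z ≡ t
redirect-at π z t = transpose-left (π ⟨$⟩ʳ z) t

redirect-keeps : ∀ {n} (π : Permutation′ n) {z t w s} → w ≢ z → π ⟨$⟩ʳ w ≡ s → s ≢ t →
  redirect π z t ⟨$⟩ʳ w ≡ s
redirect-keeps π w≢z refl s≢t = transpose-other (w≢z ∘ Injection.injective (↔⇒↣ π)) s≢t

alternating-colouring : ∀ G {u v x y : Fin (N G)} → u ≢ v → u ≢ x → u ≢ y → v ≢ x → v ≢ y → x ≢ y →
  ∃ λ π → colour G π u ≡ true × colour G π v ≡ false × colour G π x ≡ true × colour G π y ≡ false
alternating-colouring G {u} {v} {x} {y} u≢v u≢x u≢y v≢x v≢y x≢y =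
  πy , colour-at {πy} {u} 0F πy-u , colour-at {πy} {v} 1F πy-v
     , colour-at {πy} {x} 2F πy-x , colour-at {πy} {y} 3F (redirect-at πx y (t 3F))
  where
  4≤N = four-distinct⇒4≤ u≢v u≢x u≢y v≢x v≢y x≢y
  t : Fin 4 → Fin (N G)
  t i = inject≤ i 4≤N
  t-≢ : ∀ {i j} → i ≢ j → t i ≢ t j
  t-≢ {i} {j} i≢j = i≢j ∘ inject≤-injective 4≤N 4≤N i j
  colour-at : ∀ {π w} i → π ⟨$⟩ʳ w ≡ t i → colour G π w ≡ parity (suc (toℕ i))
  colour-at i πw =
    trans (cong (λ k → parity (suc (toℕ k))) πw) (cong (λ k → parity (suc k)) (toℕ-inject≤ i 4≤N))
  πu = redirect Perm.id u (t 0F)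
  πv = redirect πu v (t 1F)
  πx = redirect πv x (t 2F)
  πy = redirect πx y (t 3F)
  πv-u = redirect-keeps πu u≢v (redirect-at Perm.id u (t 0F)) (t-≢ λ ())
  πx-u = redirect-keeps πv u≢x πv-u (t-≢ λ ())
  πx-v = redirect-keeps πv v≢x (redirect-at πu v (t 1F)) (t-≢ λ ())
  πy-u = redirect-keeps πx u≢y πx-u (t-≢ λ ())
  πy-v = redirect-keeps πx v≢y πx-v (t-≢ λ ())
  πy-x = redirect-keeps πx x≢y (redirect-at πv x (t 2F)) (t-≢ λ ())

NegCountConstant : Graph → Set
NegCountConstant G = ∀ π π′ → negCount G π ≡ negCount G π′

adj-exchange : ∀ G → NegCountConstant G → ∀ {u v x y : Fin (N G)} →
  u ≢ v → u ≢ x → u ≢ y → v ≢ x → v ≢ y → x ≢ y →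
  toN (adj G u x) + toN (adj G v y) ≡ toN (adj G u y) + toN (adj G v x)
adj-exchange G constant {u} {v} {x} {y} u≢v u≢x u≢y v≢x v≢y x≢y
  with alternating-colouring G u≢v u≢x u≢y v≢x v≢y x≢y
... | π , cu , cv , cx , cy = *-cancelˡ-≡ _ _ 4 (+-cancelˡ-≡ (2K + 2K) _ _ square)
  where
  open ≡-Reasoning
  2K = 2 * negCount G π
  c = colour G π
  S = 4 * (toN (adj G u x) + toN (adj G v y))
  D = 4 * (toN (adj G u y) + toN (adj G v x))
  cut₂≡2K : ∀ π′ → cut₂ G (colour G π′) ≡ 2K
  cut₂≡2K π′ = trans (sym (negCount≡cut₂ G π′)) (cong (2 *_) (constant π′ π))
  square : 2K + 2K + S ≡ 2K + 2K + D
  square = begin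
      2K + 2K + S
    ≡⟨ cong₂ (λ a b → a + b + S) (sym (cut₂≡2K π))
             (sym (cut₂≡2K (transpose x y ∘ₚ (transpose u v ∘ₚ π)))) ⟩
      cut₂ G c + cut₂ G (c ∘ PC.transpose u v ∘ PC.transpose x y) + S
    ≡⟨ cut₂-transpose-square G c u≢v u≢x u≢y v≢x v≢y x≢y cu cv cx cy ⟩
      cut₂ G (c ∘ PC.transpose u v) + cut₂ G (c ∘ PC.transpose x y) + D
    ≡⟨ cong₂ (λ a b → a + b + D) (cut₂≡2K (transpose u v ∘ₚ π)) (cut₂≡2K (transpose x y ∘ₚ π)) ⟩
      2K + 2K + D
    ∎

adj⇒≢ : ∀ G {a b} → adj G a b ≡ true → a ≢ b
adj⇒≢ G {a} ab refl rewrite Graph.irrefl G a = case ab of λ ()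

triangle⇒cycle : ∀ G {a b c} → adj G a b ≡ true → adj G b c ≡ true → adj G c a ≡ true → Cycle G
triangle⇒cycle G {a} {b} {c} ab bc ca = record
  { verts    = a ∷ b ∷ c ∷ []
  ; long     = ≤-refl
  ; distinct = (adj⇒≢ G ab ∷ ≢-sym (adj⇒≢ G ca) ∷ []) ∷ (adj⇒≢ G bc ∷ []) ∷ [] ∷ []
  ; path     = p2 ab (p2 bc p1)
  ; closing  = a , c , refl , refl , ca
  }

DisjointEdgeFree : Graph → Set
DisjointEdgeFree G = ∀ {a b c d} → adj G a b ≡ true → adj G c d ≡ true →
  a ≢ c → a ≢ d → b ≢ c → b ≢ d → ⊥

toN+toN≡2 : ∀ {p q} → toN p + toN q ≡ 2 → p ≡ true × q ≡ true
toN+toN≡2 {true}  {true}  _  = refl , refl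
toN+toN≡2 {true}  {false} ()
toN+toN≡2 {false} {true}  ()
toN+toN≡2 {false} {false} ()

-- Two disjoint edges ab, cd would by adj-exchange force the edges ad, bc and ac, i.e. a triangle abc.
constant⇒disjoint-edge-free : ∀ G → Acyclic G → NegCountConstant G → DisjointEdgeFree G
constant⇒disjoint-edge-free G acyclic constant {a} {b} {c} {d} ab cd a≢c a≢d b≢c b≢d =
  acyclic (triangle⇒cycle G ab bc ca)
  where
  a≢b = adj⇒≢ G ab
  c≢d = adj⇒≢ G cd
  ad∧cb = toN+toN≡2 (trans (sym (adj-exchange G constant a≢c a≢b a≢d (≢-sym b≢c) c≢d b≢d))
                            (cong₂ (λ p q → toN p + toN q) ab cd))
  ac∧db = toN+toN≡2 (trans (sym (adj-exchange G constant a≢d a≢b a≢c (≢-sym b≢d) (≢-sym c≢d) b≢c))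
                            (cong₂ (λ p q → toN p + toN q) ab (trans (Graph.sym G d c) cd)))
  bc : adj G b c ≡ true
  bc = trans (Graph.sym G b c) (proj₂ ad∧cb)
  ca : adj G c a ≡ true
  ca = trans (Graph.sym G c a) (proj₁ ac∧db)

StarAt : (G : Graph) → Fin (N G) → Set
StarAt G s = ∀ p q → adj G p q ≡ does (p ≟ s) xor does (q ≟ s)

first-edge : ∀ {G s t} → Reach G s t → s ≢ t → ∃ λ w → adj G s w ≡ true
first-edge here         s≢s = contradiction refl s≢s
first-edge (step sw _) _   = _ , sw

edges-through⇒star : ∀ G {s} → Connected G →
  (∀ {p q} → adj G p q ≡ true → p ≡ s ⊎ q ≡ s) → StarAt G s
edges-through⇒star G {s} connected through = star-at-s
  where
  towards-centre : ∀ {w} → w ≢ s → adj G w s ≡ true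
  towards-centre {w} w≢s with first-edge (connected w s) w≢s
  ... | z , wz with through wz
  ...   | inj₁ w≡s  = contradiction w≡s w≢s
  ...   | inj₂ refl = wz
  star-at-s : StarAt G s
  star-at-s p q with p ≟ s | q ≟ s
  ... | yes refl | yes refl = Graph.irrefl G p
  ... | yes refl | no q≢s   = trans (Graph.sym G p q) (towards-centre q≢s)
  ... | no p≢s   | yes refl = towards-centre p≢s
  ... | no p≢s   | no q≢s   with adj G p q in pq
  ...   | true  = ⊥-elim ([ p≢s , q≢s ]′ (through pq))
  ...   | false = refl

leaf⇒edges-through : ∀ G → DisjointEdgeFree G → ∀ {a b} → adj G a b ≡ true →
  (∀ {w} → adj G a w ≡ true → w ≡ b) →
  ∀ {p q} → adj G p q ≡ true → p ≡ b ⊎ q ≡ b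
leaf⇒edges-through G disjoint-free {a} {b} ab leaf {p} {q} pq with p ≟ b | q ≟ b
... | yes p≡b | _        = inj₁ p≡b
... | no _    | yes q≡b  = inj₂ q≡b
... | no p≢b  | no q≢b   with p ≟ a | q ≟ a
...   | yes refl | _        = contradiction (leaf pq) q≢b
...   | no _     | yes refl = contradiction (leaf (trans (Graph.sym G a p) pq)) p≢b
...   | no p≢a   | no q≢a   =
      ⊥-elim (disjoint-free ab pq (≢-sym p≢a) (≢-sym q≢a) (≢-sym p≢b) (≢-sym q≢b))

edge⇒centre : ∀ G → DisjointEdgeFree G → Acyclic G → ∀ {a b} → adj G a b ≡ true →
  ∃ λ s → ∀ {p q} → adj G p q ≡ true → p ≡ s ⊎ q ≡ s
edge⇒centre G disjoint-free acyclic {a} {b} ab with any? (λ w → (adj G a w Bool.≟ true) ×-dec ¬? (w ≟ b))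
... | no no-other = b , leaf⇒edges-through G disjoint-free ab only-b
  where
  only-b : ∀ {w} → adj G a w ≡ true → w ≡ b
  only-b {w} aw = decidable-stable (w ≟ b) (λ w≢b → no-other (w , aw , w≢b))
... | yes (w , aw , w≢b) = a , leaf⇒edges-through G disjoint-free (trans (Graph.sym G b a) ab) only-a
  where
  only-a : ∀ {z} → adj G b z ≡ true → z ≡ a
  only-a {z} bz with z ≟ a | z ≟ w
  ... | yes z≡a | _        = z≡a
  ... | no _    | yes refl = ⊥-elim (acyclic (triangle⇒cycle G ab bz (trans (Graph.sym G z a) aw)))
  ... | no z≢a  | no z≢w   = ⊥-elim (disjoint-free aw bz (adj⇒≢ G ab) (≢-sym z≢a) w≢b (≢-sym z≢w))

¬¬-minimum : ∀ {A : Set} (f : A → ℕ) → A → ¬ ¬ (∃ λ x → ∀ y → f x ≤ f y)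
¬¬-minimum f a no-minimum = <-rec (λ m → ∀ x → f x ≡ m → ⊥) descend (f a) a refl
  where
  descend : ∀ m → (∀ {k} → k < m → ∀ x → f x ≡ k → ⊥) → ∀ x → f x ≡ m → ⊥
  descend m below x refl = no-minimum (x , λ y → ≮⇒≥ (λ fy<fx → below fy<fx y refl))

uniform⇒constant : ∀ G → (∀ k → IsRna G k → ∀ π → negCount G π ≡ k) → NegCountConstant G
uniform⇒constant G uniform π π′ = decidable-stable (negCount G π ℕ.≟ negCount G π′) λ π≢π′ →
  ¬¬-minimum (negCount G) π λ (μ , minimal) →
    let at = uniform (negCount G μ) ((μ , refl) , minimal) in π≢π′ (trans (at π) (sym (at π′)))

constant-tree⇒star : ∀ G → IsTree G → 2 ≤ N G → NegCountConstant G → ∃ (StarAt G)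
constant-tree⇒star G (connected , acyclic) 2≤N constant = s , edges-through⇒star G connected through
  where
  v₀ v₁ : Fin (N G)
  v₀ = inject≤ 0F 2≤N
  v₁ = inject≤ 1F 2≤N
  v₀≢v₁ : v₀ ≢ v₁
  v₀≢v₁ e = case inject≤-injective 2≤N 2≤N 0F 1F e of λ ()
  edge = first-edge (connected v₀ v₁) v₀≢v₁
  centre = edge⇒centre G (constant⇒disjoint-edge-free G acyclic constant) acyclic (proj₂ edge)
  s = proj₁ centre
  through = proj₂ centre

star-crossing : ∀ G {s} → StarAt G s → ∀ (c : Colouring (N G)) p q →
  toN (crossing G c p q) ≡ toN (does (p ≟ s)) * toN (c s xor c q) + toN (does (q ≟ s)) * toN (c s xor c p)
star-crossing G {s} star-at-s c p q rewrite star-at-s p q with p ≟ s | q ≟ s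
... | yes refl | yes refl rewrite xor-same (c p) = refl
... | yes refl | no _     = sym (trans (+-identityʳ _) (+-identityʳ _))
... | no _     | yes refl = trans (cong toN (xor-comm (c p) (c s))) (sym (+-identityʳ _))
... | no _     | no _     = refl

cut₂-star : ∀ G {s} → StarAt G s → ∀ (c : Colouring (N G)) → cut₂ G c ≡ 2 * ∑[ w < N G ] toN (c s xor c w)
cut₂-star G {s} star-at-s c = begin
    cut₂ G c
  ≡⟨ ∑∑-cong (star-crossing G star-at-s c) ⟩
    ∑∑ n (λ p q → A p q + A q p)
  ≡⟨ ∑∑-+ A (λ p q → A q p) ⟩
    ∑∑ n A + ∑∑ n (λ p q → A q p)
  ≡⟨ cong (∑∑ n A +_) (∑-comm A) ⟨
    ∑∑ n A + ∑∑ n A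
  ≡⟨ cong₂ _+_ from-centre (trans from-centre (sym (+-identityʳ X))) ⟩
    2 * X
  ∎
  where
  open ≡-Reasoning
  n = N G
  X = ∑[ w < n ] toN (c s xor c w)
  A : Fin n → Fin n → ℕ
  A p q = toN (does (p ≟ s)) * toN (c s xor c q)
  from-centre : ∑∑ n A ≡ X
  from-centre = trans (sum-cong-≗ (λ p → sym (*-distribˡ-sum (toN (does (p ≟ s))) (λ q → toN (c s xor c q)))))
                      (∑-pick s (λ _ → X))

disagreeing : Bool → ℕ → ℕ
disagreeing b n = ∑[ i < n ] toN (b xor parity (suc (toℕ i)))

disagreeing-false : ∀ n → disagreeing false n ≡ disagreeing true n + n % 2
disagreeing-false zero          = refl
disagreeing-false (suc zero)    = refl
disagreeing-false (suc (suc n)) = cong suc (disagreeing-false n)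

negCount-star : ∀ G {s} → StarAt G s → ∀ π → negCount G π ≡ disagreeing (colour G π s) (N G)
negCount-star G {s} star-at-s π = *-cancelˡ-≡ _ _ 2 (begin
    2 * negCount G π
  ≡⟨ negCount≡cut₂ G π ⟩
    cut₂ G (colour G π)
  ≡⟨ cut₂-star G star-at-s (colour G π) ⟩
    2 * ∑[ w < N G ] toN (b xor colour G π w)
  ≡⟨ cong (2 *_) (sum-permute (λ i → toN (b xor parity (suc (toℕ i)))) π) ⟨
    2 * disagreeing b (N G)
  ∎)
  where
  open ≡-Reasoning
  b = colour G π s

%2-suc : ∀ n → suc n % 2 + n % 2 ≡ 1
%2-suc zero          = refl
%2-suc (suc zero)    = refl
%2-suc (suc (suc n)) = %2-suc n

↔-≟ : ∀ {m n} (φ : Fin m ↔ Fin n) {s z} → Inverse.to φ s ≡ z →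
  ∀ p → does (Inverse.to φ p ≟ z) ≡ does (p ≟ s)
↔-≟ φ {s} {z} φs p with p ≟ s
... | yes refl = dec-true (Inverse.to φ p ≟ z) φs
... | no p≢s   =
    dec-false (Inverse.to φ p ≟ z) (λ φp≡z → p≢s (Injection.injective (↔⇒↣ φ) (trans φp≡z (sym φs))))

star-centre : ∀ n → StarAt (star n) Fin.zero
star-centre n Fin.zero    Fin.zero    = refl
star-centre n Fin.zero    (Fin.suc _) = refl
star-centre n (Fin.suc _) Fin.zero    = refl
star-centre n (Fin.suc _) (Fin.suc _) = refl

iso-star⇒star : ∀ G n → Iso G (star n) → ∃ (StarAt G)
iso-star⇒star G n (φ , φ-adj) = φ ⟨$⟩ˡ Fin.zero , λ p q →
  trans (sym (φ-adj p q))
        (trans (star-centre n (φ ⟨$⟩ʳ p) (φ ⟨$⟩ʳ q))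
               (cong₂ _xor_ (↔-≟ φ (Perm.inverseʳ φ) p) (↔-≟ φ (Perm.inverseʳ φ) q)))

star⇒iso-star : ∀ G {s} n → StarAt G s → N G ≡ suc n → Iso G (star n)
star⇒iso-star G {s} n star-at-s N≡1+n = φ , λ p q →
  trans (star-centre n (φ ⟨$⟩ʳ p) (φ ⟨$⟩ʳ q))
        (trans (cong₂ _xor_ (↔-≟ φ φs p) (↔-≟ φ φs q)) (sym (star-at-s p q)))
  where
  φ : Perm.Permutation (N G) (suc n)
  φ = Perm.cast-id N≡1+n ∘ₚ transpose (cast N≡1+n s) Fin.zero
  φs : φ ⟨$⟩ʳ s ≡ Fin.zero
  φs = transpose-left (cast N≡1+n s) Fin.zero

odd-star⇒uniform : ∀ T → (∃ λ n → 0 < n × Odd n × Iso T (star n)) →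
  ∀ k → IsRna T k → ∀ π → negCount T π ≡ k
odd-star⇒uniform T (n , _ , n-odd , iso) k ((π₀ , π₀≡k) , _) π =
  trans (balanced π) (trans (sym (balanced π₀)) π₀≡k)
  where
  centre = iso-star⇒star T n iso
  N-even : N T % 2 ≡ 0
  N-even = trans (cong (_% 2) (↔⇒≡ (proj₁ iso)))
                 (+-cancelʳ-≡ 1 (suc n % 2) 0 (trans (cong (suc n % 2 +_) (sym n-odd)) (%2-suc n)))
  disagreeing-even : ∀ b → disagreeing b (N T) ≡ disagreeing true (N T)
  disagreeing-even true  = refl
  disagreeing-even false =
    trans (disagreeing-false (N T)) (trans (cong (disagreeing true (N T) +_) N-even) (+-identityʳ (disagreeing true (N T))))
  balanced : ∀ π → negCount T π ≡ disagreeing true (N T)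
  balanced π = trans (negCount-star T (proj₂ centre) π) (disagreeing-even (colour T π (proj₁ centre)))

uniform⇒odd-star : ∀ T → IsTree T → N T ≥ 2 → (∀ k → IsRna T k → ∀ π → negCount T π ≡ k) →
  ∃ λ n → 0 < n × Odd n × Iso T (star n)
uniform⇒odd-star T tree 2≤N uniform = n , 0<n , n-odd , star⇒iso-star T n (proj₂ centre) N≡1+n
  where
  constant = uniform⇒constant T uniform
  centre = constant-tree⇒star T tree 2≤N constant
  s = proj₁ centre
  n = pred (N T)
  N≡1+n : N T ≡ suc n
  N≡1+n = sym (suc-pred (N T) {{>-nonZero (≤-trans (s≤s z≤n) 2≤N)}})
  0<n : 0 < n
  0<n = ≤-pred (subst (2 ≤_) N≡1+n 2≤N)
  centre-labelled : Fin 2 → Permutation′ (N T)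
  centre-labelled i = redirect Perm.id s (inject≤ i 2≤N)
  count : ∀ i → negCount T (centre-labelled i) ≡ disagreeing (parity (suc (toℕ i))) (N T)
  count i = trans (negCount-star T (proj₂ centre) (centre-labelled i))
                  (cong (λ k → disagreeing (parity (suc k)) (N T))
                        (trans (cong toℕ (redirect-at Perm.id s (inject≤ i 2≤N))) (toℕ-inject≤ i 2≤N)))
  D = disagreeing true (N T)
  N-even : N T % 2 ≡ 0
  N-even = +-cancelˡ-≡ D (N T % 2) 0 (begin
      D + N T % 2                 ≡⟨ disagreeing-false (N T) ⟨
      disagreeing false (N T)     ≡⟨ count 1F ⟨
      negCount T (centre-labelled 1F)   ≡⟨ constant (centre-labelled 1F) (centre-labelled 0F) ⟩
      negCount T (centre-labelled 0F)   ≡⟨ count 0F ⟩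
      D                           ≡⟨ +-identityʳ D ⟨
      D + 0                       ∎)
    where open ≡-Reasoning
  n-odd : Odd n
  n-odd = trans (cong (_+ n % 2) (sym (trans (cong (_% 2) (sym N≡1+n)) N-even))) (%2-suc n)

mainTheorem10 : (T : Graph) → IsTree T → N T ≥ 2 →
    ((∀ k → IsRna T k → (π : Permutation′ (N T)) → negCount T π ≡ k)
    ⇔ (∃ λ n → 0 < n × Odd n × Iso T (star n)))
mainTheorem10 T tree 2≤N = mk⇔ (uniform⇒odd-star T tree 2≤N) (odd-star⇒uniform T)
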